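{- Let $S=(S^-,\mathcal{F})$, $T=(T^-,\mathcal{F})$ be causal multiteams of the same signature that are rescalings of each other. Then for any consistent conjunction $\mathbf X=\mathbf x$, $S_{\mathbf X = \mathbf x}$ and $T_{\mathbf X = \mathbf x}$ are rescalings of each other.
   Context: A causal multiteam $T=(T^-,\mathcal{F})$ of signature $\sigma$ is a finite multiset $T^-$ of assignments together with a recursive (acyclic) function component $\mathcal{F}$ of structural equations for the endogenous variables, compatible with every row. For a consistent conjunction $\mathbf X=\mathbf x$, the intervened causal multiteam $T_{\mathbf X=\mathbf x}$ (used to evaluate the interventionist counterfactual $\mathbf X=\mathbf x\mathrel{\Box\!\!\rightarrow}\psi$) replaces each row $s$ by the unique assignment $s^{\mathcal F}_{\mathbf X=\mathbf x}$ that agrees with $\mathbf x$ on $\mathbf X$, with $s$ on the other exogenous variables, and satisfies the equations of $\mathcal{F}$ for the endogenous variables not in $\mathbf X$; the function component becomes $\mathcal{F}$ restricted to endogenous variables outside $\mathbf X$. This preserves the number of rows. For an assignment $t$, $\#(t,T)$ is the number of copies of $t$ in $T^-$ and $\epsilon^T_t=\#(t,T)/|T^-|$. $S$ and $T$ are rescalings of each other if they have the same function component and either $S^-=T^-=\emptyset$ or $\epsilon^S_t=\epsilon^T_t$ for every assignment $t$. -}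

module Defs where

open import Data.Nat using (ℕ; zero; suc; _<_)
open import Data.Fin using (Fin; _≟_)
open import Data.Fin.Properties using (all?)
open import Data.Bool using (Bool; true; false; _∧_; not)
open import Data.Maybe using (Maybe; just; nothing; is-just)
open import Data.List using (List; []; length; filter)
open import Data.Integer using (+_)
open import Data.Rational using (ℚ; 0ℚ; _/_)
open import Data.Product using (_×_; Σ)
open import Data.Sum using (_⊎_)
open import Function using (_∘_)
open import Relation.Binary.PropositionalEquality using (_≡_)
open import Relation.Nullary using (Dec)
open import Relation.Nullary.Decidable using (⌊_⌋)
open import Data.List.Membership.Propositional using (_∈_)
open import Data.List using (map)
open import Data.Nat.Properties using ()
open import Data.Nat using (NonZero)

record Signature : Set where
  field
    n   : ℕ
    rng : Fin n → ℕ
open Signature public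

Assignment : Signature → Set
Assignment σ = (i : Fin (n σ)) → Fin (rng σ i)

_≐_ : {σ : Signature} → Assignment σ → Assignment σ → Set
s ≐ t = ∀ i → s i ≡ t i

_≐?_ : {σ : Signature} → (s t : Assignment σ) → Dec (s ≐ t)
s ≐? t = all? (λ i → s i ≟ t i)

-- Function component: which variables are endogenous, and the structural
-- equation F_V (as a function of the whole assignment) for each variable
-- (only relevant for endogenous V).
record FunComp (σ : Signature) : Set where
  field
    End : Fin (n σ) → Bool
    fn  : (i : Fin (n σ)) → Assignment σ → Fin (rng σ i)
open FunComp public

-- Recursiveness (acyclicity): there is a rank such that each endogenous F_V
-- depends only on variables of strictly smaller rank.
Recursive : {σ : Signature} → FunComp σ → Set
Recursive {σ} F =
  Σ (Fin (n σ) → ℕ) λ rank →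
    ∀ i → End F i ≡ true → (s s' : Assignment σ) →
      (∀ j → rank j < rank i → s j ≡ s' j) → fn F i s ≡ fn F i s'

Compatible : {σ : Signature} → FunComp σ → Assignment σ → Set
Compatible {σ} F s = ∀ i → End F i ≡ true → s i ≡ fn F i s

SameFC : {σ : Signature} → FunComp σ → FunComp σ → Set
SameFC {σ} F G =
  (∀ i → End F i ≡ End G i) ×
  (∀ i → End F i ≡ true → (s : Assignment σ) → fn F i s ≡ fn G i s)

-- Causal multiteam: a finite multiset of rows (a list, considered up to order)
-- together with a recursive function component compatible with every row.
record CausalMultiteam (σ : Signature) : Set where
  field
    team      : List (Assignment σ)
    F         : FunComp σ
    recursive : Recursive F
    compat    : ∀ s → s ∈ team → Compatible F s
open CausalMultiteam public

record PreMultiteam (σ : Signature) : Set where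
  constructor ⟨_,_⟩
  field
    rows : List (Assignment σ)
    fc   : FunComp σ
open PreMultiteam public

underlying : {σ : Signature} → CausalMultiteam σ → PreMultiteam σ
underlying T = ⟨ team T , F T ⟩

-- A consistent conjunction X = x: a partial assignment (each variable gets at
-- most one value, so the conjunction is automatically consistent).
Intervention : Signature → Set
Intervention σ = (i : Fin (n σ)) → Maybe (Fin (rng σ i))

step : {σ : Signature} → FunComp σ → Intervention σ → Assignment σ →
       Assignment σ → Assignment σ
step F X s cur i with X i
... | just v  = v
... | nothing with End F i
...   | true  = fn F i cur
...   | false = s i

iterate : {A : Set} → ℕ → (A → A) → A → A
iterate zero    f a = a
iterate (suc k) f a = f (iterate k f a)

-- s^F_{X=x}: by recursiveness, n rounds of updating reach the unique solution
-- (every dependency chain among n variables has length < n).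
intervAssign : {σ : Signature} → FunComp σ → Intervention σ →
               Assignment σ → Assignment σ
intervAssign {σ} F X s = iterate (n σ) (step F X s) s

restrictFC : {σ : Signature} → FunComp σ → Intervention σ → FunComp σ
restrictFC F X = record
  { End = λ i → End F i ∧ not (is-just (X i))
  ; fn  = fn F }

intervene : {σ : Signature} → CausalMultiteam σ → Intervention σ →
            PreMultiteam σ
intervene T X = ⟨ map (intervAssign (F T) X) (team T) , restrictFC (F T) X ⟩

count : {σ : Signature} → Assignment σ → List (Assignment σ) → ℕ
count t rs = length (filter (λ s → s ≐? t) rs)

-- ε^T_t = #(t,T)/|T^-| (only meaningful when T^- is nonempty; set to 0 otherwise).
ε : {σ : Signature} → PreMultiteam σ → Assignment σ → ℚ
ε T t with length (rows T)
... | zero  = 0ℚ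
... | suc m = (+ count t (rows T)) / suc m

Rescaling : {σ : Signature} → PreMultiteam σ → PreMultiteam σ → Set
Rescaling S T =
  SameFC (fc S) (fc T) ×
  ((rows S ≡ [] × rows T ≡ []) ⊎ (∀ t → ε S t ≡ ε T t))

{-# OPTIONS --safe #-}
-- Equal frequencies of the rows of S and T mean that their row counts are proportional:
-- |T| · #(t,S) = |S| · #(t,T) for every assignment t.  Since S and T share F, intervening
-- maps the rows of both by the same function f, and by recursiveness f respects pointwise
-- equality of assignments.  So #(t, f[S]) counts the rows of S lying in the ≐-closed set
-- f⁻¹(t), and proportional counts of single ≐-classes add up to proportional counts of any
-- ≐-closed set.  Lengths are preserved, so the frequencies of the images agree as well.
module Submission where

open import Defs
open import Relation.Binary.PropositionalEquality
  using (_≡_; _≢_; refl; sym; trans; cong; cong₂; subst₂; module ≡-Reasoning)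
open import Data.Bool using (true; false; _∧_)
open import Data.Bool.Properties using (∧-conicalˡ)
open import Data.Nat using (ℕ; zero; suc; _+_; _*_; _≤_; s≤s⁻¹)
open import Data.Nat.Properties
  using (*-zeroʳ; *-comm; *-distribʳ-+; +-suc; ≤-refl; ≤-trans; m*n≡0⇒m≡0; 1+n≢0)
open import Data.Integer using (+_)
open import Data.Integer.Properties using (pos-*)
open import Data.Rational using (0ℚ; _/_)
open import Data.Rational.Properties using (normalize-injective-≃; fromℚᵘ-cong)
open import Data.Rational.Unnormalised using (mkℚᵘ; *≡*)
open import Data.List using (List; []; _∷_; length; map; filter)
open import Data.List.Properties using (length-map; filter-all; filter-none; filter-notAll; filter-≐)
open import Data.List.Relation.Unary.All as All using ()
open import Data.List.Relation.Unary.All.Properties using (all-filter)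
open import Data.List.Relation.Unary.Any using (here)
open import Data.Product using (_,_)
open import Data.Sum using (inj₁; inj₂)
open import Data.Empty using (⊥-elim)
open import Data.Maybe using (just; nothing)
open import Function using (_∘_)
open import Level using (Level; 0ℓ)
open import Relation.Nullary using (¬_; yes; no; does)
open import Relation.Unary using (Pred; Decidable) renaming (_≐_ to _≐ᵘ_)
open import Relation.Unary.Properties using (∁?)
open import Relation.Binary.Bundles using (DecSetoid)
open import Relation.Binary.Definitions using (_Respects_)

length-filter-map : ∀ {a b p} {A : Set a} {B : Set b} {P : Pred B p}
  (P? : Decidable P) (f : A → B) xs →
  length (filter P? (map f xs)) ≡ length (filter (P? ∘ f) xs)
length-filter-map P? f [] = refl
length-filter-map P? f (x ∷ xs) with does (P? (f x))
... | true  = cong suc (length-filter-map P? f xs)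
... | false = length-filter-map P? f xs

iterate-cong : {A : Set} (R : A → A → Set) {f g : A → A} →
  (∀ {x y} → R x y → R (f x) (g y)) →
  ∀ k {x y} → R x y → R (iterate k f x) (iterate k g y)
iterate-cong R f∼g zero    x∼y = x∼y
iterate-cong R f∼g (suc k) x∼y = f∼g (iterate-cong R f∼g k x∼y)

/-≡⇒cross-≡ : ∀ c d m k → + c / suc m ≡ + d / suc k → c * suc k ≡ d * suc m
/-≡⇒cross-≡ c d m k = normalize-injective-≃ c d (suc m) (suc k)

cross-≡⇒/-≡ : ∀ c d m k → c * suc k ≡ d * suc m → + c / suc m ≡ + d / suc k
cross-≡⇒/-≡ c d m k eq = fromℚᵘ-cong {mkℚᵘ (+ c) m} {mkℚᵘ (+ d) k}
  (*≡* (trans (sym (pos-* c (suc k))) (trans (cong +_ eq) (pos-* d (suc m)))))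

module Counting {c ℓ} (D : DecSetoid c ℓ) where

  open DecSetoid D renaming (Carrier to A; refl to ≈-refl; sym to ≈-sym; trans to ≈-trans)

  private
    variable
      p : Level
      P : Pred A p
      a b : ℕ
      s t : A

  countWhere : Decidable P → List A → ℕ
  countWhere P? xs = length (filter P? xs)

  occurrences : A → List A → ℕ
  occurrences t = countWhere (_≟ t)

  remove : A → List A → List A
  remove s = filter (∁? (_≟ s))

  occurrences-here : ∀ xs → occurrences s (s ∷ xs) ≡ suc (occurrences s xs)
  occurrences-here {s} xs with s ≟ s
  ... | yes _   = refl
  ... | no s≉s = ⊥-elim (s≉s ≈-refl)

  countWhere-split : ∀ {q} {Q : Pred A q} (P? : Decidable P) (Q? : Decidable Q) xs →
    countWhere P? xs ≡ countWhere P? (filter Q? xs) + countWhere P? (filter (∁? Q?) xs)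
  countWhere-split P? Q? [] = refl
  countWhere-split P? Q? (x ∷ xs) with does (Q? x)
  ... | true with does (P? x)
  ...   | true  = cong suc (countWhere-split P? Q? xs)
  ...   | false = countWhere-split P? Q? xs
  countWhere-split P? Q? (x ∷ xs) | false with does (P? x)
  ...   | true  = trans (cong suc (countWhere-split P? Q? xs)) (sym (+-suc _ _))
  ...   | false = countWhere-split P? Q? xs

  countWhere-class : (P? : Decidable P) → P Respects _≈_ → P s → ∀ xs →
    countWhere P? (filter (_≟ s) xs) ≡ occurrences s xs
  countWhere-class P? resp Ps xs = cong length (filter-all P?
    (All.map (λ x≈s → resp (≈-sym x≈s) Ps) (all-filter (_≟ _) xs)))

  countWhere-class-∁ : (P? : Decidable P) → P Respects _≈_ → ¬ P s → ∀ xs →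
    countWhere P? (filter (_≟ s) xs) ≡ 0
  countWhere-class-∁ P? resp ¬Ps xs = cong length (filter-none P?
    (All.map (λ x≈s Px → ¬Ps (resp x≈s Px)) (all-filter (_≟ _) xs)))

  occurrences-remove-≈ : t ≈ s → ∀ xs → occurrences t (remove s xs) ≡ 0
  occurrences-remove-≈ t≈s xs = cong length (filter-none (_≟ _)
    (All.map (λ x≉s x≈t → x≉s (≈-trans x≈t t≈s)) (all-filter (∁? (_≟ _)) xs)))

  occurrences-remove-≉ : ¬ t ≈ s → ∀ xs → occurrences t (remove s xs) ≡ occurrences t xs
  occurrences-remove-≉ {t} {s} t≉s xs = begin
    occurrences t (remove s xs)
      ≡⟨ cong (_+ occurrences t (remove s xs)) (countWhere-class-∁ (_≟ t) resp (t≉s ∘ ≈-sym) xs) ⟨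
    countWhere (_≟ t) (filter (_≟ s) xs) + occurrences t (remove s xs)
      ≡⟨ countWhere-split (_≟ t) (_≟ s) xs ⟨
    occurrences t xs
      ∎
    where
    open ≡-Reasoning
    resp : (_≈ t) Respects _≈_
    resp x≈y x≈t = ≈-trans (≈-sym x≈y) x≈t

  Proportional : ℕ → ℕ → List A → List A → Set c
  Proportional a b xs ys = ∀ t → occurrences t xs * b ≡ occurrences t ys * a

  Proportional-remove : ∀ s {xs ys} → Proportional a b xs ys →
    Proportional a b (remove s xs) (remove s ys)
  Proportional-remove s {xs} {ys} prop t with t ≟ s
  ... | yes t≈s rewrite occurrences-remove-≈ t≈s xs | occurrences-remove-≈ t≈s ys = refl
  ... | no  t≉s rewrite occurrences-remove-≉ t≉s xs | occurrences-remove-≉ t≉s ys = prop t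

  Proportional-countWhere-class : (P? : Decidable P) → P Respects _≈_ → ∀ s {xs ys} →
    Proportional a b xs ys →
    countWhere P? (filter (_≟ s) xs) * b ≡ countWhere P? (filter (_≟ s) ys) * a
  Proportional-countWhere-class P? resp s {xs} {ys} prop with P? s
  ... | yes Ps rewrite countWhere-class P? resp Ps xs | countWhere-class P? resp Ps ys = prop s
  ... | no ¬Ps rewrite countWhere-class-∁ P? resp ¬Ps xs | countWhere-class-∁ P? resp ¬Ps ys = refl

  -- Split off the ≈-class of the head of xs: the class counts are proportional by hypothesis,
  -- and what remains is again proportional and strictly shorter.
  Proportional⇒countWhere : (P? : Decidable P) → P Respects _≈_ → ∀ {xs ys} →
    Proportional a b xs ys → countWhere P? xs * b ≡ countWhere P? ys * a
  Proportional⇒countWhere {a = a} {b = b} P? resp {xs} {ys} =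
    go (length xs) {a} {b} {xs} {ys} ≤-refl
    where
    go : ∀ n {a b xs ys} → length xs ≤ n →
      Proportional a b xs ys → countWhere P? xs * b ≡ countWhere P? ys * a
    go n {xs = []} {[]}     _ _    = refl
    go n {a = a} {xs = []} {y ∷ ys} _ prop =
      sym (trans (cong (countWhere P? (y ∷ ys) *_) a≡0) (*-zeroʳ (countWhere P? (y ∷ ys))))
      where
      a≡0 : a ≡ 0
      a≡0 = m*n≡0⇒m≡0 a (suc (occurrences y ys))
        (trans (*-comm a _) (trans (cong (_* a) (sym (occurrences-here ys))) (sym (prop y))))
    go (suc n) {a} {b} {s ∷ xs} {ys} |xs|≤n prop = begin
      countWhere P? (s ∷ xs) * b                ≡⟨ cong (_* b) (countWhere-split P? (_≟ s) (s ∷ xs)) ⟩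
      (inClass (s ∷ xs) + outside (s ∷ xs)) * b ≡⟨ *-distribʳ-+ b (inClass (s ∷ xs)) _ ⟩
      inClass (s ∷ xs) * b + outside (s ∷ xs) * b
        ≡⟨ cong₂ _+_ (Proportional-countWhere-class P? resp s {s ∷ xs} {ys} prop)
                     (go n {xs = remove s (s ∷ xs)} {remove s ys} |remove|≤n
                       (Proportional-remove s {s ∷ xs} {ys} prop)) ⟩
      inClass ys * a + outside ys * a           ≡⟨ *-distribʳ-+ a (inClass ys) _ ⟨
      (inClass ys + outside ys) * a             ≡⟨ cong (_* a) (countWhere-split P? (_≟ s) ys) ⟨
      countWhere P? ys * a                      ∎
      where
      open ≡-Reasoning
      inClass outside : List A → ℕ
      inClass zs = countWhere P? (filter (_≟ s) zs)
      outside zs = countWhere P? (remove s zs)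
      |remove|≤n : length (remove s (s ∷ xs)) ≤ n
      |remove|≤n = s≤s⁻¹ (≤-trans
        (filter-notAll (∁? (_≟ s)) (s ∷ xs) (here (λ s≉s → s≉s ≈-refl))) |xs|≤n)

  Proportional-map : (f : A → A) → (∀ {x y} → x ≈ y → f x ≈ f y) → ∀ {xs ys} →
    Proportional a b xs ys → Proportional a b (map f xs) (map f ys)
  Proportional-map {a} {b} f f-cong {xs} {ys} prop t = begin
    occurrences t (map f xs) * b       ≡⟨ cong (_* b) (length-filter-map (_≟ t) f xs) ⟩
    countWhere ((_≟ t) ∘ f) xs * b
      ≡⟨ Proportional⇒countWhere {a = a} {b} ((_≟ t) ∘ f) resp {xs} {ys} prop ⟩
    countWhere ((_≟ t) ∘ f) ys * a     ≡⟨ cong (_* a) (length-filter-map (_≟ t) f ys) ⟨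
    occurrences t (map f ys) * a       ∎
    where
    open ≡-Reasoning
    resp : (λ x → f x ≈ t) Respects _≈_
    resp x≈y fx≈t = ≈-trans (≈-sym (f-cong x≈y)) fx≈t

  occurrences-map-cong : ∀ {f g : A → A} → (∀ x → f x ≈ g x) → ∀ t xs →
    occurrences t (map f xs) ≡ occurrences t (map g xs)
  occurrences-map-cong {f} {g} f≈g t xs = begin
    occurrences t (map f xs)       ≡⟨ length-filter-map (_≟ t) f xs ⟩
    countWhere ((_≟ t) ∘ f) xs     ≡⟨ cong length (filter-≐ ((_≟ t) ∘ f) ((_≟ t) ∘ g) same xs) ⟩
    countWhere ((_≟ t) ∘ g) xs     ≡⟨ length-filter-map (_≟ t) g xs ⟨
    occurrences t (map g xs)       ∎
    where
    open ≡-Reasoning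
    same : (λ x → f x ≈ t) ≐ᵘ (λ x → g x ≈ t)
    same = (λ {x} → ≈-trans (≈-sym (f≈g x))) , (λ {x} → ≈-trans (f≈g x))

≐-decSetoid : Signature → DecSetoid 0ℓ 0ℓ
≐-decSetoid σ = record
  { Carrier          = Assignment σ
  ; _≈_              = _≐_
  ; isDecEquivalence = record
    { isEquivalence = record
      { refl  = λ _ → refl
      ; sym   = λ s≐t i → sym (s≐t i)
      ; trans = λ s≐t t≐u i → trans (s≐t i) (t≐u i)
      }
    ; _≟_ = _≐?_
    }
  }

module _ {σ : Signature} where

  open Counting (≐-decSetoid σ)

  private
    variable
      H K H′ K′ : FunComp σ

  ε≡⇒Proportional : ∀ xs ys → (∀ t → ε ⟨ xs , H ⟩ t ≡ ε ⟨ ys , K ⟩ t) →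
    Proportional (length xs) (length ys) xs ys
  ε≡⇒Proportional []       ys       _   t = sym (*-zeroʳ (occurrences t ys))
  ε≡⇒Proportional xs@(_ ∷ _) []     _   t = *-zeroʳ (occurrences t xs)
  ε≡⇒Proportional xs@(_ ∷ xs′) ys@(_ ∷ ys′) ε≡ε t =
    /-≡⇒cross-≡ (occurrences t xs) (occurrences t ys) (length xs′) (length ys′) (ε≡ε t)

  Proportional⇒ε≡ : ∀ x xs y ys →
    Proportional (length (x ∷ xs)) (length (y ∷ ys)) (x ∷ xs) (y ∷ ys) →
    ∀ t → ε ⟨ x ∷ xs , H ⟩ t ≡ ε ⟨ y ∷ ys , K ⟩ t
  Proportional⇒ε≡ x xs y ys prop t =
    cross-≡⇒/-≡ (occurrences t (x ∷ xs)) (occurrences t (y ∷ ys)) (length xs) (length ys) (prop t)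

  ε-here-≢-0 : ∀ y ys → ε ⟨ y ∷ ys , H ⟩ y ≢ 0ℚ
  ε-here-≢-0 y ys ε≡0 = 1+n≢0 (trans (sym (occurrences-here ys))
    (m*n≡0⇒m≡0 _ 1 (/-≡⇒cross-≡ (occurrences y (y ∷ ys)) 0 (length ys) 0 ε≡0)))

  ε-map : (f : Assignment σ → Assignment σ) → (∀ {s s′} → s ≐ s′ → f s ≐ f s′) →
    ∀ xs ys → (∀ t → ε ⟨ xs , H ⟩ t ≡ ε ⟨ ys , K ⟩ t) →
    ∀ t → ε ⟨ map f xs , H′ ⟩ t ≡ ε ⟨ map f ys , K′ ⟩ t
  ε-map f f-cong []       []       _   t = refl
  ε-map {K = K} f f-cong [] (y ∷ ys) ε≡ε t = ⊥-elim (ε-here-≢-0 {H = K} y ys (sym (ε≡ε y)))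
  ε-map {H = H} f f-cong (x ∷ xs) [] ε≡ε t = ⊥-elim (ε-here-≢-0 {H = H} x xs (ε≡ε x))
  ε-map {H} {K} {H′} {K′} f f-cong (x ∷ xs) (y ∷ ys) ε≡ε =
    Proportional⇒ε≡ {H = H′} {K = K′} (f x) (map f xs) (f y) (map f ys)
      (subst₂ (λ a b → Proportional a b (map f (x ∷ xs)) (map f (y ∷ ys)))
        (sym (length-map f (x ∷ xs))) (sym (length-map f (y ∷ ys)))
        (Proportional-map {a = length (x ∷ xs)} {length (y ∷ ys)} f f-cong {x ∷ xs} {y ∷ ys}
          (ε≡⇒Proportional {H = H} {K = K} (x ∷ xs) (y ∷ ys) ε≡ε)))

  ε-map-cong : ∀ {f g : Assignment σ → Assignment σ} → (∀ s → f s ≐ g s) →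
    ∀ xs t → ε ⟨ map f xs , H ⟩ t ≡ ε ⟨ map g xs , K ⟩ t
  ε-map-cong f≐g [] t = refl
  ε-map-cong {f = f} {g} f≐g (x ∷ xs) t =
    cong₂ (λ c m → + c / suc m) (occurrences-map-cong f≐g t (x ∷ xs))
      (trans (length-map f xs) (sym (length-map g xs)))

module _ {σ : Signature} where

  SameFC-refl : (H : FunComp σ) → SameFC H H
  SameFC-refl H = (λ _ → refl) , (λ _ _ _ → refl)

  restrictFC-SameFC : ∀ {H K : FunComp σ} (X : Intervention σ) → SameFC H K →
    SameFC (restrictFC H X) (restrictFC K X)
  restrictFC-SameFC X (End≡ , fn≡) =
    (λ i → cong (_∧ _) (End≡ i)) , (λ i endo s → fn≡ i (∧-conicalˡ _ _ endo) s)

  fn-cong : ∀ {H : FunComp σ} → Recursive H → ∀ {i} → End H i ≡ true →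
    ∀ {s s′} → s ≐ s′ → fn H i s ≡ fn H i s′
  fn-cong (_ , determined-by-lower-ranks) endo s≐s′ =
    determined-by-lower-ranks _ endo _ _ (λ j _ → s≐s′ j)

  step-cong : ∀ {H K : FunComp σ} → SameFC H K → Recursive H → ∀ X {s s′ c c′} →
    s ≐ s′ → c ≐ c′ → step H X s c ≐ step K X s′ c′
  step-cong {H} {K} (End≡ , fn≡) rec X {c′ = c′} s≐s′ c≐c′ i with X i
  ... | just _  = refl
  ... | nothing with End H i in endo | End K i | End≡ i
  ...   | true  | .true  | refl = trans (fn-cong rec endo c≐c′) (fn≡ i endo c′)
  ...   | false | .false | refl = s≐s′ i

  intervAssign-cong : ∀ {H K : FunComp σ} → SameFC H K → Recursive H → ∀ X {s s′} →
    s ≐ s′ → intervAssign H X s ≐ intervAssign K X s′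
  intervAssign-cong same rec X s≐s′ =
    iterate-cong _≐_ (step-cong same rec X s≐s′) (n σ) s≐s′

mainTheorem11 : {σ : Signature} (S T : CausalMultiteam σ) →
    Rescaling (underlying S) (underlying T) →
    (X : Intervention σ) →
    Rescaling (intervene S X) (intervene T X)
mainTheorem11 S T (same , inj₁ (S-empty , T-empty)) X =
  restrictFC-SameFC X same ,
  inj₁ (cong (map (intervAssign (F S) X)) S-empty , cong (map (intervAssign (F T) X)) T-empty)
mainTheorem11 S T (same , inj₂ εS≡εT) X = restrictFC-SameFC X same , inj₂ λ t → begin
  ε (intervene S X) t
    ≡⟨ ε-map {H = F S} {F T} {restrictFC (F S) X} {restrictFC (F T) X}
         (intervAssign (F S) X) (intervAssign-cong (SameFC-refl (F S)) (recursive S) X)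
         (team S) (team T) εS≡εT t ⟩
  ε ⟨ map (intervAssign (F S) X) (team T) , restrictFC (F T) X ⟩ t
    ≡⟨ ε-map-cong {H = restrictFC (F T) X} {restrictFC (F T) X}
         (λ s → intervAssign-cong same (recursive S) X (λ _ → refl)) (team T) t ⟩
  ε (intervene T X) t ∎
  where open ≡-Reasoning
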